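{- Let $G=(V,E)$ be a directed graph with nonnegative edge capacities $c$ and root $r\in V$, and suppose $(G,r)$ is rooted $\varphi$-conditioned for some $\varphi>0$. Let $T\subseteq V\setminus\{r\}$, $\lambda>0$, and let $(A,B\cup\{t^\star\})$ be a minimum $(r,t^\star)$-cut in the $(\lambda,T)$-flow problem, where $r\in A$ and $A\cup B=V$ is a partition. Then the contracted graph $G/A$ (with root the contracted vertex) is rooted $\varphi$-conditioned and has at most $\lambda|T\cap B|/\varphi$ edges.
   Context: For $S\subseteq V$, $\partial^-(S)$ is the set of arcs entering $S$ and $c(\partial^-(S))$ its total capacity. $\deg^-(v)$ denotes the unweighted in-degree of $v$, and the in-volume of $U\subseteq V$ is $\mathrm{vol}^-(U)=\sum_{v\in U}\deg^-(v)$. $(G,r)$ is rooted $\varphi$-conditioned if $c(\partial^-(U))\ge\varphi\,\mathrm{vol}^-(U)$ for all $U\subseteq V\setminus\{r\}$. The $(\lambda,T)$-flow problem is the maximum flow problem with source $r$ and sink $t^\star$ on the network obtained from $G$ by adding a new vertex $t^\star$ and, for every $t\in T$, an arc $(t,t^\star)$ of capacity $\lambda$. $G/A$ is the graph obtained by contracting the vertex set $A$ (which contains $r$) into the root vertex $r$, deleting the resulting self-loops and all arcs going into the root.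
   Formalization: The edge capacities $c$ and the parameters $\varphi$ and $\lambda$ are rational. -}

module Defs where

open import Data.Bool using (Bool; true; false; if_then_else_; _∧_; not)
open import Data.Nat using (ℕ; suc)
open import Data.Fin using (Fin; inject₁; fromℕ; _≟_)
open import Data.Fin.Subset using (Subset; _∈_; _∉_; _⊆_; ⊤; ∁; _∪_; ⁅_⁆)
open import Data.Vec using (lookup; _∷ʳ_)
open import Data.List using (List; []; _∷_; map; filterᵇ; length; allFin; _++_; foldr)
open import Data.List.Relation.Unary.All using (All)
open import Data.Rational using (ℚ; 0ℚ; _+_; _*_; _≤_; _<_)
open import Data.Integer using (+_)
import Data.Rational as Q
open import Data.Product using (_×_)
open import Relation.Nullary.Decidable using (⌊_⌋)
open import Relation.Unary using (Decidable)
open import Relation.Nullary using (yes; no)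

ℕ→ℚ : ℕ → ℚ
ℕ→ℚ m = (+ m) Q./ 1

record Arc (n : ℕ) : Set where
  constructor arc
  field
    tail : Fin n
    head : Fin n
    cap  : ℚ
open Arc public

Graph : ℕ → Set
Graph n = List (Arc n)

NonnegCaps : ∀ {n} → Graph n → Set
NonnegCaps es = All (λ e → 0ℚ ≤ cap e) es

mem : ∀ {n} → Subset n → Fin n → Bool
mem S v = lookup S v

sumℚ : List ℚ → ℚ
sumℚ = foldr _+_ 0ℚ

enters : ∀ {n} → Subset n → Arc n → Bool
enters S e = mem S (head e) ∧ not (mem S (tail e))

leaves : ∀ {n} → Subset n → Arc n → Bool
leaves S e = mem S (tail e) ∧ not (mem S (head e))

capIn : ∀ {n} → Graph n → Subset n → ℚ
capIn es S = sumℚ (map cap (filterᵇ (λ e → enters S e) es))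

capOut : ∀ {n} → Graph n → Subset n → ℚ
capOut es S = sumℚ (map cap (filterᵇ (λ e → leaves S e) es))

indeg : ∀ {n} → Graph n → Fin n → ℕ
indeg es v = length (filterᵇ (λ e → ⌊ head e ≟ v ⌋) es)

vol : ∀ {n} → Graph n → Subset n → ℕ
vol {n} es U = foldr (λ v acc → (if mem U v then indeg es v else 0) Data.Nat.+ acc) 0 (allFin n)

-- (G, r) rooted φ-conditioned, where the graph lives on the vertex set W ⊆ Fin n
-- (r ∈ W, all arcs have endpoints in W): c(∂⁻U) ≥ φ vol⁻(U) for all U ⊆ W ∖ {r}.
RootedConditionedOn : ∀ {n} → Subset n → Graph n → Fin n → ℚ → Set
RootedConditionedOn {n} W es r φ =
  (U : Subset n) → U ⊆ W → r ∉ U → φ * ℕ→ℚ (vol es U) ≤ capIn es U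

RootedConditioned : ∀ {n} → Graph n → Fin n → ℚ → Set
RootedConditioned es r φ = RootedConditionedOn ⊤ es r φ

-- The (λ,T)-flow network: vertex set Fin (suc n), where Fin n embeds via inject₁
-- and t⋆ = fromℕ n; arcs of G plus an arc (t, t⋆) of capacity λ for each t ∈ T.
tStar : (n : ℕ) → Fin (suc n)
tStar n = fromℕ n

liftArc : ∀ {n} → Arc n → Arc (suc n)
liftArc e = arc (inject₁ (tail e)) (inject₁ (head e)) (cap e)

flowNetwork : ∀ {n} → Graph n → ℚ → Subset n → Graph (suc n)
flowNetwork {n} es lam T =
  map liftArc es ++ map (λ t → arc (inject₁ t) (tStar n) lam) (filterᵇ (λ t → mem T t) (allFin n))

IsMinCut : ∀ {m} → Graph m → Fin m → Fin m → Subset m → Set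
IsMinCut {m} N s t S =
  s ∈ S × t ∉ S × ((S′ : Subset m) → s ∈ S′ → t ∉ S′ → capOut N S ≤ capOut N S′)

liftSide : ∀ {n} → Subset n → Subset (suc n)
liftSide A = A ∷ʳ false

-- G/A: the vertices of A are identified with the root r; self-loops and arcs
-- into the root are deleted.  Vertices are kept as Fin n (the vertex set of G/A is
-- (V ∖ A) ∪ {r}, see contractedVertices).
rep : ∀ {n} → Subset n → Fin n → Fin n → Fin n
rep A r v = if mem A v then r else v

keepArc : ∀ {n} → Subset n → Fin n → Arc n → Bool
keepArc A r e = not (⌊ rep A r (head e) ≟ r ⌋) ∧ not (⌊ rep A r (tail e) ≟ rep A r (head e) ⌋)

contract : ∀ {n} → Graph n → Subset n → Fin n → Graph n
contract es A r =
  map (λ e → arc (rep A r (tail e)) (rep A r (head e)) (cap e)) (filterᵇ (λ e → keepArc A r e) es)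

contractedVertices : ∀ {n} → Subset n → Fin n → Subset n
contractedVertices A r = ∁ A ∪ ⁅ r ⁆

{-# OPTIONS --safe #-}
module Submission where

-- Contracting A deletes arcs and redirects tails lying in A to the root, so for every
-- U ⊆ V ∖ A with r ∉ U the arcs entering U, with their capacities, are exactly those of G,
-- while in-degrees can only drop; hence G/A inherits φ-conditioning.  Every surviving arc
-- has its head in B = V ∖ A, so |E(G/A)| ≤ vol⁻(B) ≤ c(∂⁻B)/φ = c(∂⁺A)/φ.  Finally,
-- comparing the minimum cut A with the cut V in the (λ,T)-flow network gives
-- c(∂⁺A) + λ|T ∩ A| ≤ λ|T|, that is, c(∂⁺A) ≤ λ|T ∩ B|.

open import Defs
open import Data.Bool as Bool using (Bool; true; false; if_then_else_; _∧_; not)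
import Data.Bool.Properties as BoolP
open import Data.Nat as ℕ using (ℕ; zero; suc; z≤n; s≤s)
import Data.Nat.Properties as ℕP
open import Algebra.Properties.CommutativeSemigroup ℕP.+-commutativeSemigroup
  using () renaming (interchange to +-interchange)
open import Data.Fin using (Fin; inject₁; fromℕ; _≟_; zero; suc)
open import Data.Fin.Subset using (Subset; _∈_; _∉_; _⊆_; ∁; _∩_; _∪_; ⁅_⁆; ⊤; ∣_∣)
open import Data.Fin.Subset.Properties using (∈⊤; x∈∁p⇒x∉p; x∈p⇒x∉∁p; x∈p∪q⁻; x∈⁅y⁆⇒x≡y; ∩-identityʳ)
open import Data.Vec using (Vec; lookup; _∷ʳ_; _∷_; [])
import Data.Vec.Properties as VP
open import Data.List as List using (List; []; _∷_; map; filterᵇ; length; _++_; foldr; allFin)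
import Data.List.Properties as LP
open import Data.List.Membership.Propositional using () renaming (_∈_ to _∈ₗ_)
open import Data.List.Membership.Propositional.Properties using (∈-allFin)
open import Data.List.Relation.Unary.Any using (here; there)
import Data.List.Relation.Unary.All as All
open import Data.Rational using (ℚ; 0ℚ; 1ℚ; mkℚ; *≤*; _+_; -_; _*_; 1/_; _≤_; _<_; _÷_; Positive; NonNegative)
open import Data.Rational.Properties
  using (pos⇒nonZero; pos⇒nonNeg; 1/pos⇒pos; normalize-coprime; toℚᵘ-injective; toℚᵘ-homo-+;
         +-identityˡ; +-comm; +-assoc; +-inverseˡ; +-monoʳ-≤;
         *-identityʳ; *-zeroʳ; *-assoc; *-comm; *-inverseʳ; *-distribˡ-+;
         *-monoˡ-≤-nonNeg; *-monoʳ-≤-nonNeg; module ≤-Reasoning)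
import Data.Rational.Unnormalised as ℚᵘ
import Data.Rational.Unnormalised.Properties as ℚᵘP
import Data.Integer as ℤ
import Data.Integer.Properties as ℤP
import Data.Nat.Coprimality as Coprimality
open import Data.Product using (_×_; _,_)
open import Data.Sum using (inj₁; inj₂)
open import Function using (_∘_; id)
open import Relation.Nullary using (¬_; contradiction)
open import Relation.Nullary.Decidable using (⌊_⌋; T?)
open import Relation.Binary.PropositionalEquality

private variable
  X Y : Set
  n : ℕ

filterᵇ-cong : {p q : X → Bool} → (∀ x → p x ≡ q x) → (xs : List X) → filterᵇ p xs ≡ filterᵇ q xs
filterᵇ-cong {p = p} {q} p≗q =
  LP.filter-≐ (T? ∘ p) (T? ∘ q) ((λ {x} → subst Bool.T (p≗q x)) , (λ {x} → subst Bool.T (sym (p≗q x))))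

filterᵇ-map : (p : Y → Bool) (f : X → Y) (xs : List X) → filterᵇ p (map f xs) ≡ map f (filterᵇ (p ∘ f) xs)
filterᵇ-map p f [] = refl
filterᵇ-map p f (x ∷ xs) with p (f x)
... | true  = cong (f x ∷_) (filterᵇ-map p f xs)
... | false = filterᵇ-map p f xs

filterᵇ-filterᵇ : (p q : X → Bool) (xs : List X) → filterᵇ q (filterᵇ p xs) ≡ filterᵇ (λ x → p x ∧ q x) xs
filterᵇ-filterᵇ p q [] = refl
filterᵇ-filterᵇ p q (x ∷ xs) with p x
... | false = filterᵇ-filterᵇ p q xs
... | true with q x
...   | true  = cong (x ∷_) (filterᵇ-filterᵇ p q xs)
...   | false = filterᵇ-filterᵇ p q xs

filterᵇ-filterᵇ-⇒ : {p q : X → Bool} → (∀ x → q x ≡ true → p x ≡ true) → (xs : List X) →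
                    filterᵇ q (filterᵇ p xs) ≡ filterᵇ q xs
filterᵇ-filterᵇ-⇒ {p = p} {q} q⇒p xs = trans (filterᵇ-filterᵇ p q xs) (filterᵇ-cong p∧q≡q xs)
  where
  p∧q≡q : ∀ x → p x ∧ q x ≡ q x
  p∧q≡q x with q x in qx
  ... | true  = trans (BoolP.∧-identityʳ (p x)) (q⇒p x qx)
  ... | false = BoolP.∧-zeroʳ (p x)

length-filterᵇ-mono : {p q : X → Bool} → (∀ x → p x ≡ true → q x ≡ true) → (xs : List X) →
                      length (filterᵇ p xs) ℕ.≤ length (filterᵇ q xs)
length-filterᵇ-mono p⇒q [] = z≤n
length-filterᵇ-mono {p = p} {q} p⇒q (x ∷ xs) with p x in px | q x in qx
... | true  | true  = s≤s (length-filterᵇ-mono p⇒q xs)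
... | true  | false = contradiction (trans (sym (p⇒q x px)) qx) λ ()
... | false | true  = ℕP.m≤n⇒m≤1+n (length-filterᵇ-mono p⇒q xs)
... | false | false = length-filterᵇ-mono p⇒q xs

length-filterᵇ-tabulate : (p : X → Bool) (f : Fin n → X) (S : Subset n) → (∀ i → p (f i) ≡ lookup S i) →
                          length (filterᵇ p (List.tabulate f)) ≡ ∣ S ∣
length-filterᵇ-tabulate p f [] _ = refl
length-filterᵇ-tabulate p f (b ∷ S) p∘f≗S with p (f zero) | p∘f≗S zero
... | true  | refl = cong suc (length-filterᵇ-tabulate p (f ∘ suc) S (p∘f≗S ∘ suc))
... | false | refl = length-filterᵇ-tabulate p (f ∘ suc) S (p∘f≗S ∘ suc)

length-filterᵇ-∩ : (p q : Subset n) → length (filterᵇ (mem q) (filterᵇ (mem p) (allFin n))) ≡ ∣ p ∩ q ∣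
length-filterᵇ-∩ {n} p q = trans (cong length (filterᵇ-filterᵇ (mem p) (mem q) (allFin n)))
  (length-filterᵇ-tabulate (λ i → mem p i ∧ mem q i) id (p ∩ q) (λ i → sym (VP.lookup-zipWith _∧_ i p q)))

∣p∣≡∣p∩q∣+∣p∩∁q∣ : (p q : Subset n) → ∣ p ∣ ≡ ∣ p ∩ q ∣ ℕ.+ ∣ p ∩ ∁ q ∣
∣p∣≡∣p∩q∣+∣p∩∁q∣ []          []          = refl
∣p∣≡∣p∩q∣+∣p∩∁q∣ (true  ∷ p) (true  ∷ q) = cong suc (∣p∣≡∣p∩q∣+∣p∩∁q∣ p q)
∣p∣≡∣p∩q∣+∣p∩∁q∣ (true  ∷ p) (false ∷ q) =
  trans (cong suc (∣p∣≡∣p∩q∣+∣p∩∁q∣ p q)) (sym (ℕP.+-suc ∣ p ∩ q ∣ ∣ p ∩ ∁ q ∣))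
∣p∣≡∣p∩q∣+∣p∩∁q∣ (false ∷ p) (_     ∷ q) = ∣p∣≡∣p∩q∣+∣p∩∁q∣ p q

lookup≡false : {x : Fin n} {p : Subset n} → x ∉ p → lookup p x ≡ false
lookup≡false {x = x} {p} x∉p with lookup p x in px
... | true  = contradiction (VP.lookup⇒[]= x p px) x∉p
... | false = refl

lookup-∷ʳ-inject₁ : (S : Vec Bool n) (b : Bool) (v : Fin n) → lookup (S ∷ʳ b) (inject₁ v) ≡ lookup S v
lookup-∷ʳ-inject₁ (_ ∷ S) b zero    = refl
lookup-∷ʳ-inject₁ (_ ∷ S) b (suc v) = lookup-∷ʳ-inject₁ S b v

lookup-∷ʳ-fromℕ : (S : Vec Bool n) (b : Bool) → lookup (S ∷ʳ b) (fromℕ n) ≡ b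
lookup-∷ʳ-fromℕ []      b = refl
lookup-∷ʳ-fromℕ (_ ∷ S) b = lookup-∷ʳ-fromℕ S b

⌊≟⌋-refl : (x : Fin n) → ⌊ x ≟ x ⌋ ≡ true
⌊≟⌋-refl x = cong ⌊_⌋ (≡-≟-identity _≟_ refl)

⌊≟⌋-≢ : {x y : Fin n} → x ≢ y → ⌊ x ≟ y ⌋ ≡ false
⌊≟⌋-≢ x≢y = cong ⌊_⌋ (≢-≟-identity _≟_ x≢y)

sumBy : (X → ℕ) → List X → ℕ
sumBy g = foldr (λ x acc → g x ℕ.+ acc) 0

sumBy-mono : {g h : X → ℕ} → (∀ x → g x ℕ.≤ h x) → (xs : List X) → sumBy g xs ℕ.≤ sumBy h xs
sumBy-mono g≤h []       = z≤n
sumBy-mono g≤h (x ∷ xs) = ℕP.+-mono-≤ (g≤h x) (sumBy-mono g≤h xs)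

sumBy-+ : (g h : X → ℕ) (xs : List X) → sumBy (λ x → g x ℕ.+ h x) xs ≡ sumBy g xs ℕ.+ sumBy h xs
sumBy-+ g h []       = refl
sumBy-+ g h (x ∷ xs) = trans (cong (g x ℕ.+ h x ℕ.+_) (sumBy-+ g h xs)) (+-interchange (g x) (h x) _ _)

∈⇒≤sumBy : (g : X → ℕ) {x : X} {xs : List X} → x ∈ₗ xs → g x ℕ.≤ sumBy g xs
∈⇒≤sumBy g {xs = y ∷ xs} (here refl) = ℕP.m≤m+n (g y) _
∈⇒≤sumBy g {xs = y ∷ xs} (there x∈xs) = ℕP.≤-trans (∈⇒≤sumBy g x∈xs) (ℕP.m≤n+m _ (g y))

coprimeTo-1 : ∀ m → Coprimality.Coprime m 1
coprimeTo-1 m = Coprimality.sym (Coprimality.1-coprimeTo m)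

sumℚ-++ : (xs ys : List ℚ) → sumℚ (xs ++ ys) ≡ sumℚ xs + sumℚ ys
sumℚ-++ []       ys = sym (+-identityˡ (sumℚ ys))
sumℚ-++ (x ∷ xs) ys = trans (cong (x +_) (sumℚ-++ xs ys)) (sym (+-assoc x (sumℚ xs) (sumℚ ys)))

ℕ→ℚ≡mkℚ : ∀ m → ℕ→ℚ m ≡ mkℚ (ℤ.+ m) 0 (coprimeTo-1 m)
ℕ→ℚ≡mkℚ m = normalize-coprime (coprimeTo-1 m)

ℕ→ℚ-mono : ∀ {a b} → a ℕ.≤ b → ℕ→ℚ a ≤ ℕ→ℚ b
ℕ→ℚ-mono {a} {b} a≤b rewrite ℕ→ℚ≡mkℚ a | ℕ→ℚ≡mkℚ b =
  *≤* (ℤP.*-monoʳ-≤-nonNeg (ℤ.+ 1) (ℤ.+≤+ a≤b))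

ℕ→ℚ-+ : ∀ a b → ℕ→ℚ (a ℕ.+ b) ≡ ℕ→ℚ a + ℕ→ℚ b
ℕ→ℚ-+ a b rewrite ℕ→ℚ≡mkℚ (a ℕ.+ b) | ℕ→ℚ≡mkℚ a | ℕ→ℚ≡mkℚ b =
  toℚᵘ-injective (ℚᵘP.≃-sym (ℚᵘP.≃-trans
    (toℚᵘ-homo-+ (mkℚ (ℤ.+ a) 0 (coprimeTo-1 a)) (mkℚ (ℤ.+ b) 0 (coprimeTo-1 b))) sum≃))
  where
  sum≃ : ℚᵘ.mkℚᵘ (ℤ.+ a) 0 ℚᵘ.+ ℚᵘ.mkℚᵘ (ℤ.+ b) 0 ℚᵘ.≃ ℚᵘ.mkℚᵘ (ℤ.+ (a ℕ.+ b)) 0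
  sum≃ = ℚᵘ.*≡* (cong (ℤ._* ℤ.+ 1) (cong₂ ℤ._+_ (ℤP.*-identityʳ (ℤ.+ a)) (ℤP.*-identityʳ (ℤ.+ b))))

sumℚ-const : (c : ℚ) (xs : List X) → sumℚ (map (λ _ → c) xs) ≡ c * ℕ→ℚ (length xs)
sumℚ-const c []       = sym (*-zeroʳ c)
sumℚ-const c (x ∷ xs) = begin
  c + sumℚ (map (λ _ → c) xs)          ≡⟨ cong₂ _+_ (sym (*-identityʳ c)) (sumℚ-const c xs) ⟩
  c * 1ℚ + c * ℕ→ℚ (length xs)         ≡⟨ *-distribˡ-+ c 1ℚ (ℕ→ℚ (length xs)) ⟨
  c * (1ℚ + ℕ→ℚ (length xs))           ≡⟨ cong (c *_) (ℕ→ℚ-+ 1 (length xs)) ⟨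
  c * ℕ→ℚ (suc (length xs))            ∎
  where open ≡-Reasoning

+-cancelˡ-≤ : ∀ y {x z} → y + x ≤ y + z → x ≤ z
+-cancelˡ-≤ y {x} {z} y+x≤y+z = subst₂ _≤_ (-y+[y+w]≡w x) (-y+[y+w]≡w z) (+-monoʳ-≤ (- y) y+x≤y+z)
  where
  open ≡-Reasoning
  -y+[y+w]≡w : ∀ w → - y + (y + w) ≡ w
  -y+[y+w]≡w w = begin
    - y + (y + w)   ≡⟨ +-assoc (- y) y w ⟨
    - y + y + w     ≡⟨ cong (_+ w) (+-inverseˡ y) ⟩
    0ℚ + w          ≡⟨ +-identityˡ w ⟩
    w               ∎

*≤⇒≤÷ : ∀ φ .{{_ : Positive φ}} {x y} → φ * x ≤ y → x ≤ (y ÷ φ) {{pos⇒nonZero φ}}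
*≤⇒≤÷ φ {x} {y} φx≤y =
  subst (_≤ y * 1/φ) φx/φ≡x (*-monoʳ-≤-nonNeg 1/φ {{pos⇒nonNeg 1/φ {{1/pos⇒pos φ}}}} φx≤y)
  where
  open ≡-Reasoning
  1/φ : ℚ
  1/φ = (1/ φ) {{pos⇒nonZero φ}}
  φx/φ≡x : φ * x * 1/φ ≡ x
  φx/φ≡x = begin
    φ * x * 1/φ     ≡⟨ cong (_* 1/φ) (*-comm φ x) ⟩
    x * φ * 1/φ     ≡⟨ *-assoc x φ 1/φ ⟩
    x * (φ * 1/φ)   ≡⟨ cong (x *_) (*-inverseʳ φ {{pos⇒nonZero φ}}) ⟩
    x * 1ℚ          ≡⟨ *-identityʳ x ⟩
    x               ∎

vol-mono : {G H : Graph n} → (∀ v → indeg G v ℕ.≤ indeg H v) → (U : Subset n) → vol G U ℕ.≤ vol H U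
vol-mono {n} {G} {H} indegG≤indegH U = sumBy-mono restricted≤ (allFin n)
  where
  restricted≤ : ∀ v → (if mem U v then indeg G v else 0) ℕ.≤ (if mem U v then indeg H v else 0)
  restricted≤ v with mem U v
  ... | true  = indegG≤indegH v
  ... | false = z≤n

indeg-∷-≥ : (e : Arc n) (G : Graph n) (v : Fin n) → indeg G v ℕ.≤ indeg (e ∷ G) v
indeg-∷-≥ e G v with ⌊ head e ≟ v ⌋
... | true  = ℕP.n≤1+n (indeg G v)
... | false = ℕP.≤-refl

length-filterᵇ-head∈≤vol : (G : Graph n) (U : Subset n) → length (filterᵇ (mem U ∘ head) G) ℕ.≤ vol G U
length-filterᵇ-head∈≤vol [] U = z≤n
length-filterᵇ-head∈≤vol {n} (e ∷ G) U with mem U (head e) in h∈U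
... | false = ℕP.≤-trans (length-filterᵇ-head∈≤vol G U) (vol-mono {G = G} {e ∷ G} (indeg-∷-≥ e G) U)
... | true  = begin
  suc (length (filterᵇ (mem U ∘ head) G))     ≤⟨ ℕP.+-mono-≤ 1≤δ[h] (length-filterᵇ-head∈≤vol G U) ⟩
  sumBy δ (allFin n) ℕ.+ vol G U              ≡⟨ sumBy-+ δ ρ (allFin n) ⟨
  sumBy (λ v → δ v ℕ.+ ρ v) (allFin n)        ≤⟨ sumBy-mono δ+ρ≤ (allFin n) ⟩
  vol (e ∷ G) U                               ∎
  where
  open ℕP.≤-Reasoning
  δ ρ : Fin n → ℕ
  δ v = if mem U v ∧ ⌊ head e ≟ v ⌋ then 1 else 0
  ρ v = if mem U v then indeg G v else 0
  1≤δ[h] : 1 ℕ.≤ sumBy δ (allFin n)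
  1≤δ[h] = subst (λ b → (if b then 1 else 0) ℕ.≤ sumBy δ (allFin n))
                 (cong₂ _∧_ h∈U (⌊≟⌋-refl (head e))) (∈⇒≤sumBy δ (∈-allFin (head e)))
  δ+ρ≤ : ∀ v → δ v ℕ.+ ρ v ℕ.≤ (if mem U v then indeg (e ∷ G) v else 0)
  δ+ρ≤ v with mem U v
  ... | false = z≤n
  ... | true with ⌊ head e ≟ v ⌋
  ...   | true  = ℕP.≤-refl
  ...   | false = ℕP.≤-refl

capIn-∁ : (G : Graph n) (S : Subset n) → capIn G (∁ S) ≡ capOut G S
capIn-∁ G S = cong (sumℚ ∘ map cap) (filterᵇ-cong enters∁≡leaves G)
  where
  enters∁≡leaves : ∀ e → enters (∁ S) e ≡ leaves S e
  enters∁≡leaves e rewrite VP.lookup-map (head e) not S | VP.lookup-map (tail e) not S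
    with lookup S (head e) | lookup S (tail e)
  ... | true  | true  = refl
  ... | true  | false = refl
  ... | false | true  = refl
  ... | false | false = refl

capOut-++ : (G H : Graph n) (S : Subset n) → capOut (G ++ H) S ≡ capOut G S + capOut H S
capOut-++ G H S = begin
  sumℚ (map cap (filterᵇ (leaves S) (G ++ H)))
    ≡⟨ cong (sumℚ ∘ map cap) (LP.filter-++ (T? ∘ leaves S) G H) ⟩
  sumℚ (map cap (filterᵇ (leaves S) G ++ filterᵇ (leaves S) H))
    ≡⟨ cong sumℚ (LP.map-++ cap (filterᵇ (leaves S) G) _) ⟩
  sumℚ (map cap (filterᵇ (leaves S) G) ++ map cap (filterᵇ (leaves S) H))
    ≡⟨ sumℚ-++ (map cap (filterᵇ (leaves S) G)) _ ⟩
  capOut G S + capOut H S ∎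
  where open ≡-Reasoning

capOut-⊤ : (G : Graph n) → capOut G ⊤ ≡ 0ℚ
capOut-⊤ G = cong (sumℚ ∘ map cap) (LP.filter-none (T? ∘ leaves ⊤) (All.universal ¬leaves⊤ G))
  where
  ¬leaves⊤ : ∀ e → ¬ Bool.T (leaves ⊤ e)
  ¬leaves⊤ e rewrite VP.lookup-replicate (tail e) true | VP.lookup-replicate (head e) true = λ ()

module _ (A : Subset n) (r : Fin n) where

  contractArc : Arc n → Arc n
  contractArc e = arc (rep A r (tail e)) (rep A r (head e)) (cap e)

  keepArc⇒head∉ : (e : Arc n) → keepArc A r e ≡ true → mem A (head e) ≡ false
  keepArc⇒head∉ e kept with mem A (head e)
  ... | false = refl
  ... | true  = contradiction (trans (sym kept) (cong (λ b → not b ∧ not ⌊ rep A r (tail e) ≟ r ⌋) (⌊≟⌋-refl r)))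
                              λ ()

  indeg-contract≤ : (G : Graph n) (v : Fin n) → indeg (contract G A r) v ℕ.≤ indeg G v
  indeg-contract≤ G v = begin
    length (filterᵇ into-v (map contractArc kept))
      ≡⟨ cong length (filterᵇ-map into-v contractArc kept) ⟩
    length (map contractArc (filterᵇ (into-v ∘ contractArc) kept))
      ≡⟨ LP.length-map contractArc (filterᵇ (into-v ∘ contractArc) kept) ⟩
    length (filterᵇ (into-v ∘ contractArc) kept)
      ≡⟨ cong length (filterᵇ-filterᵇ (keepArc A r) (into-v ∘ contractArc) G) ⟩
    length (filterᵇ (λ e → keepArc A r e ∧ into-v (contractArc e)) G)
      ≤⟨ length-filterᵇ-mono kept-into-v⇒into-v G ⟩
    indeg G v ∎
    where
    open ℕP.≤-Reasoning
    kept : Graph n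
    kept = filterᵇ (keepArc A r) G
    into-v : Arc n → Bool
    into-v e = ⌊ head e ≟ v ⌋
    kept-into-v⇒into-v : ∀ e → keepArc A r e ∧ into-v (contractArc e) ≡ true → into-v e ≡ true
    kept-into-v⇒into-v e k∧i with keepArc A r e in e-kept
    ... | true = subst (λ h → ⌊ h ≟ v ⌋ ≡ true) (cong (if_then r else head e) (keepArc⇒head∉ e e-kept)) k∧i

  vol-contract≤ : (G : Graph n) (U : Subset n) → vol (contract G A r) U ℕ.≤ vol G U
  vol-contract≤ G = vol-mono {G = contract G A r} {G} (indeg-contract≤ G)

  length-contract≤vol∁ : (G : Graph n) → length (contract G A r) ℕ.≤ vol G (∁ A)
  length-contract≤vol∁ G = begin
    length (contract G A r)                       ≡⟨ LP.length-map contractArc (filterᵇ (keepArc A r) G) ⟩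
    length (filterᵇ (keepArc A r) G)              ≤⟨ length-filterᵇ-mono kept⇒head∈∁A G ⟩
    length (filterᵇ (mem (∁ A) ∘ head) G)         ≤⟨ length-filterᵇ-head∈≤vol G (∁ A) ⟩
    vol G (∁ A)                                   ∎
    where
    open ℕP.≤-Reasoning
    kept⇒head∈∁A : ∀ e → keepArc A r e ≡ true → mem (∁ A) (head e) ≡ true
    kept⇒head∈∁A e kept = trans (VP.lookup-map (head e) not A) (cong not (keepArc⇒head∉ e kept))

  module _ {U : Subset n} (U⊆∁A : U ⊆ ∁ A) (r∉U : r ∉ U) where

    mem-rep : ∀ v → mem U (rep A r v) ≡ mem U v
    mem-rep v with mem A v in v∈A
    ... | true  = trans (lookup≡false r∉U) (sym (lookup≡false v∉U))
      where
      v∉U : v ∉ U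
      v∉U v∈U = x∈∁p⇒x∉p (U⊆∁A v∈U) (VP.lookup⇒[]= v A v∈A)
    ... | false = refl

    enters-contractArc : ∀ e → enters U (contractArc e) ≡ enters U e
    enters-contractArc e = cong₂ (λ h t → h ∧ not t) (mem-rep (head e)) (mem-rep (tail e))

    enters⇒keepArc : ∀ e → enters U e ≡ true → keepArc A r e ≡ true
    enters⇒keepArc e enters≡true with mem U (head e) in h∈U | mem U (tail e) in t∉U
    ... | true | false = cong₂ (λ a b → not a ∧ not b) (⌊≟⌋-≢ rep-h≢r) (⌊≟⌋-≢ rep-t≢rep-h)
      where
      open ≡-Reasoning
      rep-h≢r : rep A r (head e) ≢ r
      rep-h≢r eq = contradiction (begin
        true                          ≡⟨ h∈U ⟨
        mem U (head e)                ≡⟨ mem-rep (head e) ⟨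
        mem U (rep A r (head e))      ≡⟨ cong (mem U) eq ⟩
        mem U r                       ≡⟨ lookup≡false r∉U ⟩
        false                         ∎) λ ()
      rep-t≢rep-h : rep A r (tail e) ≢ rep A r (head e)
      rep-t≢rep-h eq = contradiction (begin
        false                         ≡⟨ t∉U ⟨
        mem U (tail e)                ≡⟨ mem-rep (tail e) ⟨
        mem U (rep A r (tail e))      ≡⟨ cong (mem U) eq ⟩
        mem U (rep A r (head e))      ≡⟨ mem-rep (head e) ⟩
        mem U (head e)                ≡⟨ h∈U ⟩
        true                          ∎) λ ()

    capIn-contract : (G : Graph n) → capIn (contract G A r) U ≡ capIn G U
    capIn-contract G = begin
      sumℚ (map cap (filterᵇ (enters U) (map contractArc kept)))
        ≡⟨ cong (sumℚ ∘ map cap) (filterᵇ-map (enters U) contractArc kept) ⟩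
      sumℚ (map cap (map contractArc (filterᵇ (enters U ∘ contractArc) kept)))
        ≡⟨ cong sumℚ (LP.map-∘ (filterᵇ (enters U ∘ contractArc) kept)) ⟨
      sumℚ (map cap (filterᵇ (enters U ∘ contractArc) kept))
        ≡⟨ cong (sumℚ ∘ map cap) (filterᵇ-cong enters-contractArc kept) ⟩
      sumℚ (map cap (filterᵇ (enters U) kept))
        ≡⟨ cong (sumℚ ∘ map cap) (filterᵇ-filterᵇ-⇒ enters⇒keepArc G) ⟩
      capIn G U ∎
      where
      open ≡-Reasoning
      kept : Graph n
      kept = filterᵇ (keepArc A r) G

⊆∁∪⁅⁆⇒⊆∁ : {U A : Subset n} {r : Fin n} → U ⊆ ∁ A ∪ ⁅ r ⁆ → r ∉ U → U ⊆ ∁ A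
⊆∁∪⁅⁆⇒⊆∁ {A = A} {r} U⊆∁A∪⁅r⁆ r∉U {v} v∈U with x∈p∪q⁻ (∁ A) ⁅ r ⁆ (U⊆∁A∪⁅r⁆ v∈U)
... | inj₁ v∈∁A  = v∈∁A
... | inj₂ v∈⁅r⁆ = contradiction (subst (_∈ _) (x∈⁅y⁆⇒x≡y r v∈⁅r⁆) v∈U) r∉U

contract-rootedConditioned : {G : Graph n} {r : Fin n} {φ : ℚ} .{{_ : NonNegative φ}} (A : Subset n) →
  RootedConditioned G r φ → RootedConditionedOn (contractedVertices A r) (contract G A r) r φ
contract-rootedConditioned {G = G} {r} {φ} A conditioned U U⊆∁A∪⁅r⁆ r∉U = begin
  φ * ℕ→ℚ (vol (contract G A r) U)   ≤⟨ *-monoˡ-≤-nonNeg φ (ℕ→ℚ-mono (vol-contract≤ A r G U)) ⟩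
  φ * ℕ→ℚ (vol G U)                  ≤⟨ conditioned U (λ _ → ∈⊤) r∉U ⟩
  capIn G U                          ≡⟨ capIn-contract A r (⊆∁∪⁅⁆⇒⊆∁ U⊆∁A∪⁅r⁆ r∉U) r∉U G ⟨
  capIn (contract G A r) U           ∎
  where open ≤-Reasoning

module _ (G : Graph n) (lam : ℚ) (T : Subset n) where

  capOut-liftArcs : (S : Subset n) → capOut (map liftArc G) (liftSide S) ≡ capOut G S
  capOut-liftArcs S = begin
    sumℚ (map cap (filterᵇ (leaves (liftSide S)) (map liftArc G)))
      ≡⟨ cong (sumℚ ∘ map cap) (filterᵇ-map (leaves (liftSide S)) liftArc G) ⟩
    sumℚ (map cap (map liftArc (filterᵇ (leaves (liftSide S) ∘ liftArc) G)))
      ≡⟨ cong sumℚ (LP.map-∘ (filterᵇ (leaves (liftSide S) ∘ liftArc) G)) ⟨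
    sumℚ (map cap (filterᵇ (leaves (liftSide S) ∘ liftArc) G))
      ≡⟨ cong (sumℚ ∘ map cap) (filterᵇ-cong leaves-liftArc G) ⟩
    capOut G S ∎
    where
    open ≡-Reasoning
    leaves-liftArc : ∀ e → leaves (liftSide S) (liftArc e) ≡ leaves S e
    leaves-liftArc e =
      cong₂ (λ t h → t ∧ not h) (lookup-∷ʳ-inject₁ S false (tail e)) (lookup-∷ʳ-inject₁ S false (head e))

  sinkArc : Fin n → Arc (suc n)
  sinkArc t = arc (inject₁ t) (tStar n) lam

  capOut-sinkArcs : (S : Subset n) →
                    capOut (map sinkArc (filterᵇ (mem T) (allFin n))) (liftSide S) ≡ lam * ℕ→ℚ ∣ T ∩ S ∣
  capOut-sinkArcs S = begin
    sumℚ (map cap (filterᵇ (leaves (liftSide S)) (map sinkArc terminals)))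
      ≡⟨ cong (sumℚ ∘ map cap) (filterᵇ-map (leaves (liftSide S)) sinkArc terminals) ⟩
    sumℚ (map cap (map sinkArc (filterᵇ (leaves (liftSide S) ∘ sinkArc) terminals)))
      ≡⟨ cong (sumℚ ∘ map cap ∘ map sinkArc) (filterᵇ-cong leaves-sinkArc terminals) ⟩
    sumℚ (map cap (map sinkArc (filterᵇ (mem S) terminals)))
      ≡⟨ cong sumℚ (LP.map-∘ (filterᵇ (mem S) terminals)) ⟨
    sumℚ (map (λ _ → lam) (filterᵇ (mem S) terminals))
      ≡⟨ sumℚ-const lam (filterᵇ (mem S) terminals) ⟩
    lam * ℕ→ℚ (length (filterᵇ (mem S) terminals))
      ≡⟨ cong (λ k → lam * ℕ→ℚ k) (length-filterᵇ-∩ T S) ⟩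
    lam * ℕ→ℚ ∣ T ∩ S ∣ ∎
    where
    open ≡-Reasoning
    terminals : List (Fin n)
    terminals = filterᵇ (mem T) (allFin n)
    leaves-sinkArc : ∀ t → leaves (liftSide S) (sinkArc t) ≡ mem S t
    leaves-sinkArc t = trans (cong₂ (λ a b → a ∧ not b) (lookup-∷ʳ-inject₁ S false t) (lookup-∷ʳ-fromℕ S false))
                             (BoolP.∧-identityʳ (mem S t))

  capOut-flowNetwork : (S : Subset n) → capOut (flowNetwork G lam T) (liftSide S) ≡ capOut G S + lam * ℕ→ℚ ∣ T ∩ S ∣
  capOut-flowNetwork S = trans (capOut-++ (map liftArc G) _ (liftSide S)) (cong₂ _+_ (capOut-liftArcs S) (capOut-sinkArcs S))

  minCut⇒capOut≤ : {r : Fin n} {A : Subset n} → IsMinCut (flowNetwork G lam T) (inject₁ r) (tStar n) (liftSide A) →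
                   capOut G A ≤ lam * ℕ→ℚ ∣ T ∩ ∁ A ∣
  minCut⇒capOut≤ {r} {A} (_ , _ , minimal) = +-cancelˡ-≤ (lam * ℕ→ℚ ∣ T ∩ A ∣) (begin
    lam * ℕ→ℚ ∣ T ∩ A ∣ + capOut G A               ≡⟨ +-comm _ (capOut G A) ⟩
    capOut G A + lam * ℕ→ℚ ∣ T ∩ A ∣               ≡⟨ capOut-flowNetwork A ⟨
    capOut (flowNetwork G lam T) (liftSide A)      ≤⟨ minimal (liftSide ⊤) r∈V t⋆∉V ⟩
    capOut (flowNetwork G lam T) (liftSide ⊤)      ≡⟨ capOut-flowNetwork ⊤ ⟩
    capOut G ⊤ + lam * ℕ→ℚ ∣ T ∩ ⊤ ∣
      ≡⟨ cong₂ (λ c k → c + lam * ℕ→ℚ k) (capOut-⊤ G) (cong ∣_∣ (∩-identityʳ T)) ⟩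
    0ℚ + lam * ℕ→ℚ ∣ T ∣                           ≡⟨ +-identityˡ _ ⟩
    lam * ℕ→ℚ ∣ T ∣                                ≡⟨ cong (λ k → lam * ℕ→ℚ k) (∣p∣≡∣p∩q∣+∣p∩∁q∣ T A) ⟩
    lam * ℕ→ℚ (∣ T ∩ A ∣ ℕ.+ ∣ T ∩ ∁ A ∣)          ≡⟨ cong (lam *_) (ℕ→ℚ-+ ∣ T ∩ A ∣ ∣ T ∩ ∁ A ∣) ⟩
    lam * (ℕ→ℚ ∣ T ∩ A ∣ + ℕ→ℚ ∣ T ∩ ∁ A ∣)        ≡⟨ *-distribˡ-+ lam _ _ ⟩
    lam * ℕ→ℚ ∣ T ∩ A ∣ + lam * ℕ→ℚ ∣ T ∩ ∁ A ∣    ∎)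
    where
    open ≤-Reasoning
    r∈V : inject₁ r ∈ liftSide ⊤
    r∈V = VP.lookup⇒[]= (inject₁ r) (liftSide ⊤) (trans (lookup-∷ʳ-inject₁ ⊤ false r) (VP.lookup-replicate r true))
    t⋆∉V : tStar n ∉ liftSide ⊤
    t⋆∉V t⋆∈V = contradiction (trans (sym (VP.[]=⇒lookup t⋆∈V)) (lookup-∷ʳ-fromℕ (⊤ {n}) false)) λ ()

mainTheorem4 : {n : ℕ} (G : Graph n) (r : Fin n) (φ : ℚ) .{{_ : Positive φ}}
  → NonnegCaps G
  → RootedConditioned G r φ
  → (T : Subset n) → r ∉ T
  → (lam : ℚ) → 0ℚ < lam
  → (A : Subset n) → r ∈ A
  → IsMinCut (flowNetwork G lam T) (inject₁ r) (tStar n) (liftSide A)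
  → RootedConditionedOn (contractedVertices A r) (contract G A r) r φ
    × ℕ→ℚ (length (contract G A r)) ≤ _÷_ (lam * ℕ→ℚ ∣ T ∩ ∁ A ∣) φ {{pos⇒nonZero φ}}
mainTheorem4 G r φ _ conditioned T _ lam _ A r∈A minCut =
  contract-rootedConditioned {G = G} {r} {φ} {{pos⇒nonNeg φ}} A conditioned ,
  *≤⇒≤÷ φ (begin
    φ * ℕ→ℚ (length (contract G A r))
      ≤⟨ *-monoˡ-≤-nonNeg φ {{pos⇒nonNeg φ}} (ℕ→ℚ-mono (length-contract≤vol∁ A r G)) ⟩
    φ * ℕ→ℚ (vol G (∁ A))               ≤⟨ conditioned (∁ A) (λ _ → ∈⊤) (x∈p⇒x∉∁p r∈A) ⟩
    capIn G (∁ A)                       ≡⟨ capIn-∁ G A ⟩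
    capOut G A                          ≤⟨ minCut⇒capOut≤ G lam T minCut ⟩
    lam * ℕ→ℚ ∣ T ∩ ∁ A ∣               ∎)
  where open ≤-Reasoning
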